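{- For every formula $A$ of $\mathsf{IL}^\omega$, $(|A^{+}|^{\mathbf x}_{\mathbf y} \multimap (A_{DN}(\mathbf x;\mathbf y))^{+}) \,\&\, ((A_{DN}(\mathbf x;\mathbf y))^{+} \multimap |A^{+}|^{\mathbf x}_{\mathbf y})$ is provable, where $A_{DN}$ is the Diller-Nahm interpretation.
   Context: The Diller-Nahm interpretation: $(A_{\mathrm{at}})_{DN} :\equiv A_{\mathrm{at}}$; $(A\wedge B)_{DN}(\mathbf x,\mathbf v;\mathbf y,\mathbf w) :\equiv A_{DN}(\mathbf x;\mathbf y)\wedge B_{DN}(\mathbf v;\mathbf w)$; $(A\vee B)_{DN}(\mathbf x,\mathbf v,z;\mathbf y,\mathbf w) :\equiv (z=\mathsf{T}\to A_{DN}(\mathbf x;\mathbf y))\wedge(z=\mathsf{F}\to B_{DN}(\mathbf v;\mathbf w))$; $(A\to B)_{DN}(\mathbf f,\mathbf g;\mathbf x,\mathbf w) :\equiv \forall \mathbf y\in\mathbf f\mathbf x\mathbf w\, A_{DN}(\mathbf x;\mathbf y)\to B_{DN}(\mathbf g\mathbf x;\mathbf w)$; $(\forall zA)_{DN}(\mathbf f;\mathbf y,z) :\equiv A_{DN}(\mathbf f z;\mathbf y)$; $(\exists zA)_{DN}(\mathbf x,z;\mathbf y) :\equiv A_{DN}(\mathbf x;\mathbf y)$, where $\mathbf f\mathbf x\mathbf w$ are finite sets. The translation $A^{+}$: $A_{\mathrm{at}}^{+} :\equiv A_{\mathrm{at}}$ ($A_{\mathrm{at}}\not\equiv\bot$);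 $\bot^{+} :\equiv 0$; $(A\wedge B)^{+} :\equiv A^{+}\,\&\,B^{+}$; $(A\vee B)^{+} :\equiv A^{+}\oplus B^{+}$; $(A\to B)^{+} :\equiv \mathord{!}A^{+}\multimap B^{+}$; $(\forall x A)^{+} :\equiv \forall x A^{+}$; $(\exists x A)^{+} :\equiv \exists x A^{+}$. The verifying system $\mathsf{ILL}^\omega_b$ is intuitionistic linear logic over finite types plus booleans $\mathsf{T},\mathsf{F}$, equality $=^b$, conditional terms, axioms ensuring $\mathsf{T}\ne\mathsf{F}$ and every boolean is $\mathsf{T}$ or $\mathsf{F}$, extended with finite-set types $\sigma^*$, membership $\in$, and $\forall\mathbf y\in\mathbf a\,A :\equiv \forall\mathbf y(\mathord{!}(\mathbf y\in\mathbf a)\multimap A)$; $\mathrm{cond}_z(A,B) :\equiv (\mathord{!}(z=^b\mathsf{T}) \multimap A) \,\&\, (\mathord{!}(z=^b\mathsf{F}) \multimap B)$. The interpretation: $|A_{\mathrm{at}}|:\equiv A_{\mathrm{at}}$; $|A \multimap B|^{\mathbf f,\mathbf g}_{\mathbf x,\mathbf w} :\equiv |A|^{\mathbf x}_{\mathbf f\mathbf x\mathbf w} \multimap |B|^{\mathbf g\mathbf x}_{\mathbf w}$; $|A\otimes B|^{\mathbf x,\mathbf v}_{\mathbf y,\mathbf w} :\equiv |A|^{\mathbf x}_{\mathbf y}\otimes|B|^{\mathbf v}_{\mathbf w}$; $|A\,\&\,B|^{\mathbf x,\mathbf v}_{\mathbf y,\mathbf w} :\equiv |A|^{\mathbf x}_{\mathbf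 y}\,\&\,|B|^{\mathbf v}_{\mathbf w}$; $|A\oplus B|^{\mathbf x,\mathbf v,z}_{\mathbf y,\mathbf w} :\equiv \mathrm{cond}_z(|A|^{\mathbf x}_{\mathbf y},|B|^{\mathbf v}_{\mathbf w})$; $|\exists z A(z)|^{\mathbf x,z}_{\mathbf y} :\equiv |A(z)|^{\mathbf x}_{\mathbf y}$; $|\forall z A(z)|^{\mathbf f}_{\mathbf y,z} :\equiv |A(z)|^{\mathbf f z}_{\mathbf y}$; and $|\mathord{!}A|^{\mathbf x}_{\mathbf a} :\equiv \mathord{!}\,\forall\mathbf y\in\mathbf a\,|A|^{\mathbf x}_{\mathbf y}$. -}

module Defs where

open import Data.List using (List; []; _∷_; _++_; map)
open import Data.List.Relation.Binary.Permutation.Propositional using (_↭_)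
open import Data.Product using (_×_; _,_; proj₁; proj₂)
open import Relation.Binary.PropositionalEquality using (_≡_; refl; cong; cong₂; subst; sym)

infixr 20 _⇒_
infix 25 _*
infixr 5 _∷ₜ_

data Ty : Set where
  𝕟 𝕓 : Ty
  _⇒_ : Ty → Ty → Ty
  _* : Ty → Ty

Ctx : Set
Ctx = List Ty

_⇒*_ : List Ty → Ty → Ty
[] ⇒* τ = τ
(σ ∷ σs) ⇒* τ = σ ⇒ (σs ⇒* τ)

data _∋_ : Ctx → Ty → Set where
  here  : ∀ {Γ σ} → (σ ∷ Γ) ∋ σ
  there : ∀ {Γ σ τ} → Γ ∋ σ → (τ ∷ Γ) ∋ σ

data Const : Ty → Set where
  K    : ∀ {σ τ} → Const (σ ⇒ τ ⇒ σ)
  S    : ∀ {ρ σ τ} → Const ((ρ ⇒ σ ⇒ τ) ⇒ (ρ ⇒ σ) ⇒ ρ ⇒ τ)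
  zer  : Const 𝕟
  suc  : Const (𝕟 ⇒ 𝕟)
  rec  : ∀ {σ} → Const (σ ⇒ (𝕟 ⇒ σ ⇒ σ) ⇒ 𝕟 ⇒ σ)
  tt   : Const 𝕓
  ff   : Const 𝕓
  cond : ∀ {σ} → Const (𝕓 ⇒ σ ⇒ σ ⇒ σ)
  emp  : ∀ {σ} → Const (σ *)
  sng  : ∀ {σ} → Const (σ ⇒ σ *)
  uni  : ∀ {σ} → Const (σ * ⇒ σ * ⇒ σ *)

infixl 30 _·_
data Tm (Γ : Ctx) : Ty → Set where
  var : ∀ {σ} → Γ ∋ σ → Tm Γ σ
  con : ∀ {σ} → Const σ → Tm Γ σ
  _·_ : ∀ {σ τ} → Tm Γ (σ ⇒ τ) → Tm Γ σ → Tm Γ τ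

T F : ∀ {Γ} → Tm Γ 𝕓
T = con tt
F = con ff

data _▷_ {Γ : Ctx} : ∀ {σ} → Tm Γ σ → Tm Γ σ → Set where
  βK   : ∀ {σ τ} (s : Tm Γ σ) (t : Tm Γ τ) → (con K · s · t) ▷ s
  βS   : ∀ {ρ σ τ} (r : Tm Γ (ρ ⇒ σ ⇒ τ)) (s : Tm Γ (ρ ⇒ σ)) (t : Tm Γ ρ) →
         (con S · r · s · t) ▷ (r · t · (s · t))
  βR0  : ∀ {σ} (a : Tm Γ σ) f → (con rec · a · f · con zer) ▷ a
  βRS  : ∀ {σ} (a : Tm Γ σ) f n →
         (con rec · a · f · (con suc · n)) ▷ (f · n · (con rec · a · f · n))
  βcT  : ∀ {σ} (s t : Tm Γ σ) → (con cond · T · s · t) ▷ s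
  βcF  : ∀ {σ} (s t : Tm Γ σ) → (con cond · F · s · t) ▷ t
  appˡ : ∀ {σ τ} {f f' : Tm Γ (σ ⇒ τ)} {t} → f ▷ f' → (f · t) ▷ (f' · t)
  appʳ : ∀ {σ τ} {f : Tm Γ (σ ⇒ τ)} {t t'} → t ▷ t' → (f · t) ▷ (f · t')

data Tms (Γ : Ctx) : List Ty → Set where
  []ₜ  : Tms Γ []
  _∷ₜ_ : ∀ {σ σs} → Tm Γ σ → Tms Γ σs → Tms Γ (σ ∷ σs)

_++ₜ_ : ∀ {Γ σs τs} → Tms Γ σs → Tms Γ τs → Tms Γ (σs ++ τs)
[]ₜ ++ₜ ys = ys
(x ∷ₜ xs) ++ₜ ys = x ∷ₜ (xs ++ₜ ys)

takeₜ : ∀ {Γ} σs {τs} → Tms Γ (σs ++ τs) → Tms Γ σs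
takeₜ [] xs = []ₜ
takeₜ (σ ∷ σs) (x ∷ₜ xs) = x ∷ₜ takeₜ σs xs

dropₜ : ∀ {Γ} σs {τs} → Tms Γ (σs ++ τs) → Tms Γ τs
dropₜ [] xs = xs
dropₜ (σ ∷ σs) (x ∷ₜ xs) = dropₜ σs xs

headₜ : ∀ {Γ σ σs} → Tms Γ (σ ∷ σs) → Tm Γ σ
headₜ (x ∷ₜ xs) = x

app* : ∀ {Γ σs τ} → Tm Γ (σs ⇒* τ) → Tms Γ σs → Tm Γ τ
app* t []ₜ = t
app* t (x ∷ₜ xs) = app* (t · x) xs

appₜ : ∀ {Γ σs τs} → Tms Γ (map (σs ⇒*_) τs) → Tms Γ σs → Tms Γ τs
appₜ {τs = []} []ₜ xs = []ₜ
appₜ {τs = τ ∷ τs} (f ∷ₜ fs) xs = app* f xs ∷ₜ appₜ fs xs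

Ren : Ctx → Ctx → Set
Ren Γ Δ = ∀ {σ} → Δ ∋ σ → Γ ∋ σ

Sub : Ctx → Ctx → Set
Sub Γ Δ = ∀ {σ} → Δ ∋ σ → Tm Γ σ

renTm : ∀ {Γ Δ σ} → Ren Γ Δ → Tm Δ σ → Tm Γ σ
renTm r (var v) = var (r v)
renTm r (con c) = con c
renTm r (f · t) = renTm r f · renTm r t

renTms : ∀ {Γ Δ σs} → Ren Γ Δ → Tms Δ σs → Tms Γ σs
renTms r []ₜ = []ₜ
renTms r (x ∷ₜ xs) = renTm r x ∷ₜ renTms r xs

wkTm : ∀ {Γ σ τ} → Tm Γ σ → Tm (τ ∷ Γ) σ
wkTm = renTm there

liftR : ∀ {Γ Δ τ} → Ren Γ Δ → Ren (τ ∷ Γ) (τ ∷ Δ)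
liftR r here = here
liftR r (there v) = there (r v)

liftS : ∀ {Γ Δ τ} → Sub Γ Δ → Sub (τ ∷ Γ) (τ ∷ Δ)
liftS ρ here = var here
liftS ρ (there v) = wkTm (ρ v)

subTm : ∀ {Γ Δ σ} → Sub Γ Δ → Tm Δ σ → Tm Γ σ
subTm ρ (var v) = ρ v
subTm ρ (con c) = con c
subTm ρ (f · t) = subTm ρ f · subTm ρ t

idS : ∀ {Γ} → Sub Γ Γ
idS = var

_▸_ : ∀ {Γ Δ σ} → Tm Γ σ → Sub Γ Δ → Sub Γ (σ ∷ Δ)
(t ▸ ρ) here = t
(t ▸ ρ) (there v) = ρ v

_⊙_ : ∀ {Γ' Γ Δ} → Ren Γ' Γ → Sub Γ Δ → Sub Γ' Δ
(r ⊙ ρ) v = renTm r (ρ v)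

data Atom (Γ : Ctx) : Set where
  _=ℕ_ : Tm Γ 𝕟 → Tm Γ 𝕟 → Atom Γ
  _=𝔹_ : Tm Γ 𝕓 → Tm Γ 𝕓 → Atom Γ
  _∈'_ : ∀ {σ} → Tm Γ σ → Tm Γ (σ *) → Atom Γ

subAt : ∀ {Γ Δ} → Sub Γ Δ → Atom Δ → Atom Γ
subAt ρ (s =ℕ t) = subTm ρ s =ℕ subTm ρ t
subAt ρ (s =𝔹 t) = subTm ρ s =𝔹 subTm ρ t
subAt ρ (s ∈' t) = subTm ρ s ∈' subTm ρ t

infixr 6 _∧_
infixr 5 _∨_
infixr 4 _⊃_

data IForm (Γ : Ctx) : Set where
  atom : Atom Γ → IForm Γ
  ⊥'   : IForm Γ
  _∧_  : IForm Γ → IForm Γ → IForm Γ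
  _∨_  : IForm Γ → IForm Γ → IForm Γ
  _⊃_  : IForm Γ → IForm Γ → IForm Γ
  ∀'   : ∀ σ → IForm (σ ∷ Γ) → IForm Γ
  ∃'   : ∀ σ → IForm (σ ∷ Γ) → IForm Γ

infixr 6 _⊗_ _&_
infixr 5 _⊕_
infixr 4 _⊸_
infix 7 !_

data LForm (Γ : Ctx) : Set where
  atom : Atom Γ → LForm Γ
  𝟎    : LForm Γ
  _⊸_  : LForm Γ → LForm Γ → LForm Γ
  _⊗_  : LForm Γ → LForm Γ → LForm Γ
  _&_  : LForm Γ → LForm Γ → LForm Γ
  _⊕_  : LForm Γ → LForm Γ → LForm Γ
  !_   : LForm Γ → LForm Γ
  ∀ₗ   : ∀ σ → LForm (σ ∷ Γ) → LForm Γ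
  ∃ₗ   : ∀ σ → LForm (σ ∷ Γ) → LForm Γ

subL : ∀ {Γ Δ} → Sub Γ Δ → LForm Δ → LForm Γ
subL ρ (atom a) = atom (subAt ρ a)
subL ρ 𝟎 = 𝟎
subL ρ (φ ⊸ ψ) = subL ρ φ ⊸ subL ρ ψ
subL ρ (φ ⊗ ψ) = subL ρ φ ⊗ subL ρ ψ
subL ρ (φ & ψ) = subL ρ φ & subL ρ ψ
subL ρ (φ ⊕ ψ) = subL ρ φ ⊕ subL ρ ψ
subL ρ (! φ) = ! subL ρ φ
subL ρ (∀ₗ σ φ) = ∀ₗ σ (subL (liftS ρ) φ)
subL ρ (∃ₗ σ φ) = ∃ₗ σ (subL (liftS ρ) φ)

wkL : ∀ {Γ τ} → LForm Γ → LForm (τ ∷ Γ)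
wkL = subL (λ v → var (there v))

_[_] : ∀ {Γ σ} → LForm (σ ∷ Γ) → Tm Γ σ → LForm Γ
φ [ t ] = subL (t ▸ idS) φ

∀∈ₗ : ∀ {Γ σ} → Tm Γ (σ *) → LForm (σ ∷ Γ) → LForm Γ
∀∈ₗ {σ = σ} a φ = ∀ₗ σ (! atom (var here ∈' wkTm a) ⊸ φ)

data Ax : (Γ : Ctx) → List (LForm Γ) → LForm Γ → Set where
  reflℕ   : ∀ {Γ} (t : Tm Γ 𝕟) → Ax Γ [] (atom (t =ℕ t))
  refl𝔹   : ∀ {Γ} (t : Tm Γ 𝕓) → Ax Γ [] (atom (t =𝔹 t))
  leibℕ   : ∀ {Γ} (s t : Tm Γ 𝕟) (P : Atom (𝕟 ∷ Γ)) →
            Ax Γ (atom (s =ℕ t) ∷ atom P [ s ] ∷ []) (atom P [ t ])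
  leib𝔹   : ∀ {Γ} (s t : Tm Γ 𝕓) (P : Atom (𝕓 ∷ Γ)) →
            Ax Γ (atom (s =𝔹 t) ∷ atom P [ s ] ∷ []) (atom P [ t ])
  conv    : ∀ {Γ σ} (φ : LForm (σ ∷ Γ)) {s t : Tm Γ σ} → s ▷ t →
            Ax Γ (φ [ s ] ∷ []) (φ [ t ])
  conv⁻   : ∀ {Γ σ} (φ : LForm (σ ∷ Γ)) {s t : Tm Γ σ} → s ▷ t →
            Ax Γ (φ [ t ] ∷ []) (φ [ s ])
  zero≠suc : ∀ {Γ} (t : Tm Γ 𝕟) → Ax Γ (atom (con zer =ℕ (con suc · t)) ∷ []) 𝟎
  suc-inj : ∀ {Γ} (s t : Tm Γ 𝕟) →
            Ax Γ (atom ((con suc · s) =ℕ (con suc · t)) ∷ []) (atom (s =ℕ t))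
  ind     : ∀ {Γ} (φ : LForm (𝕟 ∷ Γ)) →
            Ax Γ (! (φ [ con zer ]) ∷
                  ! ∀ₗ 𝕟 (φ ⊸ subL (liftS (λ v → var (there v))) φ [ con suc · var here ]) ∷ [])
               (∀ₗ 𝕟 φ)
  T≠F     : ∀ {Γ} → Ax Γ (atom (T =𝔹 F) ∷ []) 𝟎
  bool    : ∀ {Γ} (z : Tm Γ 𝕓) → Ax Γ [] (! atom (z =𝔹 T) ⊕ ! atom (z =𝔹 F))
  ∈sng    : ∀ {Γ σ} (x : Tm Γ σ) → Ax Γ [] (atom (x ∈' (con sng · x)))
  ∈uniˡ   : ∀ {Γ σ} (y : Tm Γ σ) a b → Ax Γ (atom (y ∈' a) ∷ []) (atom (y ∈' (con uni · a · b)))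
  ∈uniʳ   : ∀ {Γ σ} (y : Tm Γ σ) a b → Ax Γ (atom (y ∈' b) ∷ []) (atom (y ∈' (con uni · a · b)))
  ∈emp    : ∀ {Γ σ} (y : Tm Γ σ) → Ax Γ (atom (y ∈' con emp) ∷ []) 𝟎
  ∀sng    : ∀ {Γ σ} (x : Tm Γ σ) (φ : LForm (σ ∷ Γ)) → Ax Γ (φ [ x ] ∷ []) (∀∈ₗ (con sng · x) φ)
  ∀uni    : ∀ {Γ σ} (a b : Tm Γ (σ *)) (φ : LForm (σ ∷ Γ)) →
            Ax Γ ((∀∈ₗ a φ & ∀∈ₗ b φ) ∷ []) (∀∈ₗ (con uni · a · b) φ)

infix 2 _∣_⊢_
data _∣_⊢_ : (Γ : Ctx) → List (LForm Γ) → LForm Γ → Set where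
  ax    : ∀ {Γ Δ φ} → Ax Γ Δ φ → Γ ∣ Δ ⊢ φ
  id    : ∀ {Γ φ} → Γ ∣ φ ∷ [] ⊢ φ
  cut   : ∀ {Γ Δ Δ' φ ψ} → Γ ∣ Δ ⊢ φ → Γ ∣ φ ∷ Δ' ⊢ ψ → Γ ∣ Δ ++ Δ' ⊢ ψ
  exch  : ∀ {Γ Δ Δ' φ} → Δ ↭ Δ' → Γ ∣ Δ ⊢ φ → Γ ∣ Δ' ⊢ φ
  ⊸R    : ∀ {Γ Δ φ ψ} → Γ ∣ φ ∷ Δ ⊢ ψ → Γ ∣ Δ ⊢ φ ⊸ ψ
  ⊸L    : ∀ {Γ Δ Δ' φ ψ χ} → Γ ∣ Δ ⊢ φ → Γ ∣ ψ ∷ Δ' ⊢ χ → Γ ∣ (φ ⊸ ψ) ∷ Δ ++ Δ' ⊢ χ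
  ⊗R    : ∀ {Γ Δ Δ' φ ψ} → Γ ∣ Δ ⊢ φ → Γ ∣ Δ' ⊢ ψ → Γ ∣ Δ ++ Δ' ⊢ φ ⊗ ψ
  ⊗L    : ∀ {Γ Δ φ ψ χ} → Γ ∣ φ ∷ ψ ∷ Δ ⊢ χ → Γ ∣ (φ ⊗ ψ) ∷ Δ ⊢ χ
  &R    : ∀ {Γ Δ φ ψ} → Γ ∣ Δ ⊢ φ → Γ ∣ Δ ⊢ ψ → Γ ∣ Δ ⊢ φ & ψ
  &L₁   : ∀ {Γ Δ φ ψ χ} → Γ ∣ φ ∷ Δ ⊢ χ → Γ ∣ (φ & ψ) ∷ Δ ⊢ χ
  &L₂   : ∀ {Γ Δ φ ψ χ} → Γ ∣ ψ ∷ Δ ⊢ χ → Γ ∣ (φ & ψ) ∷ Δ ⊢ χ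
  ⊕R₁   : ∀ {Γ Δ φ ψ} → Γ ∣ Δ ⊢ φ → Γ ∣ Δ ⊢ φ ⊕ ψ
  ⊕R₂   : ∀ {Γ Δ φ ψ} → Γ ∣ Δ ⊢ ψ → Γ ∣ Δ ⊢ φ ⊕ ψ
  ⊕L    : ∀ {Γ Δ φ ψ χ} → Γ ∣ φ ∷ Δ ⊢ χ → Γ ∣ ψ ∷ Δ ⊢ χ → Γ ∣ (φ ⊕ ψ) ∷ Δ ⊢ χ
  𝟎L    : ∀ {Γ Δ χ} → Γ ∣ 𝟎 ∷ Δ ⊢ χ
  !R    : ∀ {Γ Δ φ} → Γ ∣ map !_ Δ ⊢ φ → Γ ∣ map !_ Δ ⊢ ! φ
  der   : ∀ {Γ Δ φ χ} → Γ ∣ φ ∷ Δ ⊢ χ → Γ ∣ (! φ) ∷ Δ ⊢ χ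
  weak  : ∀ {Γ Δ φ χ} → Γ ∣ Δ ⊢ χ → Γ ∣ (! φ) ∷ Δ ⊢ χ
  contr : ∀ {Γ Δ φ χ} → Γ ∣ (! φ) ∷ (! φ) ∷ Δ ⊢ χ → Γ ∣ (! φ) ∷ Δ ⊢ χ
  ∀R    : ∀ {Γ Δ σ φ} → (σ ∷ Γ) ∣ map wkL Δ ⊢ φ → Γ ∣ Δ ⊢ ∀ₗ σ φ
  ∀L    : ∀ {Γ Δ σ φ χ} (t : Tm Γ σ) → Γ ∣ (φ [ t ]) ∷ Δ ⊢ χ → Γ ∣ (∀ₗ σ φ) ∷ Δ ⊢ χ
  ∃R    : ∀ {Γ Δ σ φ} (t : Tm Γ σ) → Γ ∣ Δ ⊢ φ [ t ] → Γ ∣ Δ ⊢ ∃ₗ σ φ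
  ∃L    : ∀ {Γ Δ σ φ χ} → (σ ∷ Γ) ∣ φ ∷ map wkL Δ ⊢ wkL χ → Γ ∣ (∃ₗ σ φ) ∷ Δ ⊢ χ

_⁺ : ∀ {Γ} → IForm Γ → LForm Γ
atom a ⁺ = atom a
⊥' ⁺ = 𝟎
(A ∧ B) ⁺ = A ⁺ & B ⁺
(A ∨ B) ⁺ = A ⁺ ⊕ B ⁺
(A ⊃ B) ⁺ = ! (A ⁺) ⊸ B ⁺
∀' σ A ⁺ = ∀ₗ σ (A ⁺)
∃' σ A ⁺ = ∃ₗ σ (A ⁺)

-- The body is given as a function
-- of the bound variables (in any extension of the context).

Body : (Ctx → Set) → Ctx → List Ty → Set
Body Fm Γ τs = ∀ {Γ'} → Ren Γ' Γ → Tms Γ' τs → Fm Γ'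

wkTms : ∀ {Γ σs τ} → Tms Γ σs → Tms (τ ∷ Γ) σs
wkTms = renTms there

∀∈I : ∀ {Γ} τs → Tms Γ (map _* τs) → Body IForm Γ τs → IForm Γ
∀∈I [] []ₜ k = k (λ v → v) []ₜ
∀∈I (τ ∷ τs) (a ∷ₜ as) k =
  ∀' τ (atom (var here ∈' wkTm a) ⊃
        ∀∈I τs (wkTms as) (λ r ys → k (λ v → r (there v)) (var (r here) ∷ₜ ys)))

∀∈L : ∀ {Γ} τs → Tms Γ (map _* τs) → Body LForm Γ τs → LForm Γ
∀∈L [] []ₜ k = k (λ v → v) []ₜ
∀∈L (τ ∷ τs) (a ∷ₜ as) k =
  ∀ₗ τ (! atom (var here ∈' wkTm a) ⊸
        ∀∈L τs (wkTms as) (λ r ys → k (λ v → r (there v)) (var (r here) ∷ₜ ys)))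

-- Diller–Nahm interpretation A_DN(𝐱;𝐲)
-- W A = types of witnesses 𝐱, C A = types of challenges 𝐲.

W C : ∀ {Δ} → IForm Δ → List Ty
W (atom a) = []
W ⊥' = []
W (A ∧ B) = W A ++ W B
W (A ∨ B) = W A ++ (W B ++ (𝕓 ∷ []))
W (A ⊃ B) = map ((W A ++ C B) ⇒*_) (map _* (C A)) ++ map (W A ⇒*_) (W B)
W (∀' σ A) = map ((σ ∷ []) ⇒*_) (W A)
W (∃' σ A) = W A ++ (σ ∷ [])
C (atom a) = []
C ⊥' = []
C (A ∧ B) = C A ++ C B
C (A ∨ B) = C A ++ C B
C (A ⊃ B) = W A ++ C B
C (∀' σ A) = C A ++ (σ ∷ [])
C (∃' σ A) = C A

-- DN A ρ 𝐱 𝐲 is A_DN(𝐱;𝐲) with the free variables of A instantiated by ρ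
DN : ∀ {Γ Δ} (A : IForm Δ) → Sub Γ Δ → Tms Γ (W A) → Tms Γ (C A) → IForm Γ
DN (atom a) ρ xs ys = atom (subAt ρ a)
DN ⊥' ρ xs ys = ⊥'
DN (A ∧ B) ρ xv yw =
  DN A ρ (takeₜ (W A) xv) (takeₜ (C A) yw) ∧ DN B ρ (dropₜ (W A) xv) (dropₜ (C A) yw)
DN (A ∨ B) ρ xvz yw =
  (atom (z =𝔹 T) ⊃ DN A ρ x (takeₜ (C A) yw)) ∧ (atom (z =𝔹 F) ⊃ DN B ρ v (dropₜ (C A) yw))
  where
    x = takeₜ (W A) xvz
    v = takeₜ (W B) (dropₜ (W A) xvz)
    z = headₜ (dropₜ (W B) (dropₜ (W A) xvz))
DN (A ⊃ B) ρ fg xw =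
  ∀∈I (C A) (appₜ f xw) (λ r ys → DN A (r ⊙ ρ) (renTms r x) ys) ⊃ DN B ρ (appₜ g x) w
  where
    f = takeₜ (map ((W A ++ C B) ⇒*_) (map _* (C A))) fg
    g = dropₜ (map ((W A ++ C B) ⇒*_) (map _* (C A))) fg
    x = takeₜ (W A) xw
    w = dropₜ (W A) xw
DN (∀' σ A) ρ f yz = DN A (z ▸ ρ) (appₜ f (z ∷ₜ []ₜ)) (takeₜ (C A) yz)
  where z = headₜ (dropₜ (C A) yz)
DN (∃' σ A) ρ xz ys = DN A (z ▸ ρ) (takeₜ (W A) xz) ys
  where z = headₜ (dropₜ (W A) xz)

WL CL : ∀ {Δ} → LForm Δ → List Ty
WL (atom a) = []
WL 𝟎 = []
WL (φ ⊸ ψ) = map ((WL φ ++ CL ψ) ⇒*_) (CL φ) ++ map (WL φ ⇒*_) (WL ψ)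
WL (φ ⊗ ψ) = WL φ ++ WL ψ
WL (φ & ψ) = WL φ ++ WL ψ
WL (φ ⊕ ψ) = WL φ ++ (WL ψ ++ (𝕓 ∷ []))
WL (! φ) = WL φ
WL (∀ₗ σ φ) = map ((σ ∷ []) ⇒*_) (WL φ)
WL (∃ₗ σ φ) = WL φ ++ (σ ∷ [])
CL (atom a) = []
CL 𝟎 = []
CL (φ ⊸ ψ) = WL φ ++ CL ψ
CL (φ ⊗ ψ) = CL φ ++ CL ψ
CL (φ & ψ) = CL φ ++ CL ψ
CL (φ ⊕ ψ) = CL φ ++ CL ψ
CL (! φ) = map _* (CL φ)
CL (∀ₗ σ φ) = CL φ ++ (σ ∷ [])
CL (∃ₗ σ φ) = CL φ

condₗ : ∀ {Γ} → Tm Γ 𝕓 → LForm Γ → LForm Γ → LForm Γ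
condₗ z A B = (! atom (z =𝔹 T) ⊸ A) & (! atom (z =𝔹 F) ⊸ B)

-- ∣ φ ∣ ρ 𝐱 𝐲 is |φ|^𝐱_𝐲 with the free variables of φ instantiated by ρ
∣_∣ : ∀ {Γ Δ} (φ : LForm Δ) → Sub Γ Δ → Tms Γ (WL φ) → Tms Γ (CL φ) → LForm Γ
∣ atom a ∣ ρ xs ys = atom (subAt ρ a)
∣ 𝟎 ∣ ρ xs ys = 𝟎
∣ φ ⊸ ψ ∣ ρ fg xw = ∣ φ ∣ ρ x (appₜ f xw) ⊸ ∣ ψ ∣ ρ (appₜ g x) w
  where
    f = takeₜ (map ((WL φ ++ CL ψ) ⇒*_) (CL φ)) fg
    g = dropₜ (map ((WL φ ++ CL ψ) ⇒*_) (CL φ)) fg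
    x = takeₜ (WL φ) xw
    w = dropₜ (WL φ) xw
∣ φ ⊗ ψ ∣ ρ xv yw =
  ∣ φ ∣ ρ (takeₜ (WL φ) xv) (takeₜ (CL φ) yw) ⊗ ∣ ψ ∣ ρ (dropₜ (WL φ) xv) (dropₜ (CL φ) yw)
∣ φ & ψ ∣ ρ xv yw =
  ∣ φ ∣ ρ (takeₜ (WL φ) xv) (takeₜ (CL φ) yw) & ∣ ψ ∣ ρ (dropₜ (WL φ) xv) (dropₜ (CL φ) yw)
∣ φ ⊕ ψ ∣ ρ xvz yw =
  condₗ z (∣ φ ∣ ρ x (takeₜ (CL φ) yw)) (∣ ψ ∣ ρ v (dropₜ (CL φ) yw))
  where
    x = takeₜ (WL φ) xvz
    v = takeₜ (WL ψ) (dropₜ (WL φ) xvz)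
    z = headₜ (dropₜ (WL ψ) (dropₜ (WL φ) xvz))
∣ ! φ ∣ ρ xs as = ! ∀∈L (CL φ) as (λ r ys → ∣ φ ∣ (r ⊙ ρ) (renTms r xs) ys)
∣ ∀ₗ σ φ ∣ ρ f yz = ∣ φ ∣ (z ▸ ρ) (appₜ f (z ∷ₜ []ₜ)) (takeₜ (CL φ) yz)
  where z = headₜ (dropₜ (CL φ) yz)
∣ ∃ₗ σ φ ∣ ρ xz ys = ∣ φ ∣ (z ▸ ρ) (takeₜ (WL φ) xz) ys
  where z = headₜ (dropₜ (WL φ) xz)

WC⁺ : ∀ {Δ} (A : IForm Δ) → (WL (A ⁺) ≡ W A) × (CL (A ⁺) ≡ C A)
WC⁺ (atom a) = refl , refl
WC⁺ ⊥' = refl , refl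
WC⁺ (A ∧ B) with WC⁺ A | WC⁺ B
... | p , q | p' , q' = cong₂ _++_ p p' , cong₂ _++_ q q'
WC⁺ (A ∨ B) with WC⁺ A | WC⁺ B
... | p , q | p' , q' = cong₂ _++_ p (cong (_++ (𝕓 ∷ [])) p') , cong₂ _++_ q q'
WC⁺ (A ⊃ B) with WC⁺ A | WC⁺ B
... | p , q | p' , q' =
  cong₂ _++_ (cong₂ (λ u v → map (u ⇒*_) v) (cong₂ _++_ p q') (cong (map _*) q))
             (cong₂ (λ u v → map (u ⇒*_) v) p p')
  , cong₂ _++_ p q'
WC⁺ (∀' σ A) with WC⁺ A
... | p , q = cong (map ((σ ∷ []) ⇒*_)) p , cong (_++ (σ ∷ [])) q
WC⁺ (∃' σ A) with WC⁺ A
... | p , q = cong (_++ (σ ∷ [])) p , q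

∣_⁺∣ : ∀ {Γ Δ} (A : IForm Δ) → Sub Γ Δ → Tms Γ (W A) → Tms Γ (C A) → LForm Γ
∣ A ⁺∣ ρ xs ys =
  ∣ A ⁺ ∣ ρ (subst (Tms _) (sym (proj₁ (WC⁺ A))) xs) (subst (Tms _) (sym (proj₂ (WC⁺ A))) ys)

module Submission where

-- The proof is an induction on A in which every case is a congruence step:
-- both sides are built from the same connectives (&, ⊸, !, ∀, bounded ∀),
-- with the atoms, ⊥, and the cond_z clauses for ∨ matching literally.

open import Defs
open import Data.List using ([]; _∷_; _++_; map)
open import Data.Product using (_×_; _,_; proj₁; proj₂)
open import Relation.Binary.PropositionalEquality
  using (_≡_; refl; cong; cong₂; subst; sym; trans)
open import Relation.Binary.PropositionalEquality.Properties using (subst-subst-sym)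
open import Data.List.Relation.Binary.Permutation.Propositional using (swap; refl)

infix 3 _⟺_
_⟺_ : ∀ {Γ} → LForm Γ → LForm Γ → Set
_⟺_ {Γ} φ ψ = (Γ ∣ φ ∷ [] ⊢ ψ) × (Γ ∣ ψ ∷ [] ⊢ φ)

⟺-refl : ∀ {Γ} {φ : LForm Γ} → φ ⟺ φ
⟺-refl = id , id

&-cong : ∀ {Γ} {φ φ' ψ ψ' : LForm Γ} → φ ⟺ φ' → ψ ⟺ ψ' → (φ & ψ) ⟺ (φ' & ψ')
&-cong (φ⊢φ' , φ'⊢φ) (ψ⊢ψ' , ψ'⊢ψ) =
  &R (&L₁ φ⊢φ') (&L₂ ψ⊢ψ') , &R (&L₁ φ'⊢φ) (&L₂ ψ'⊢ψ)

⊸-cong : ∀ {Γ} {φ φ' ψ ψ' : LForm Γ} → φ ⟺ φ' → ψ ⟺ ψ' → (φ ⊸ ψ) ⟺ (φ' ⊸ ψ')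
⊸-cong (φ⊢φ' , φ'⊢φ) (ψ⊢ψ' , ψ'⊢ψ) =
  ⊸R (exch (swap _ _ refl) (⊸L φ'⊢φ ψ⊢ψ')) , ⊸R (exch (swap _ _ refl) (⊸L φ⊢φ' ψ'⊢ψ))

-- Promotion applies because the single hypothesis ! φ is itself banged.
!-cong : ∀ {Γ} {φ ψ : LForm Γ} → φ ⟺ ψ → (! φ) ⟺ (! ψ)
!-cong {φ = φ} {ψ} (φ⊢ψ , ψ⊢φ) = !R {Δ = φ ∷ []} (der φ⊢ψ) , !R {Δ = ψ ∷ []} (der ψ⊢φ)

SubEq : ∀ {Γ Δ} → Sub Γ Δ → Sub Γ Δ → Set
SubEq {Δ = Δ} ρ ρ' = ∀ {σ} (v : Δ ∋ σ) → ρ v ≡ ρ' v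

_∘S_ : ∀ {Γ Δ Θ} → Sub Γ Δ → Sub Δ Θ → Sub Γ Θ
(ρ ∘S ρ') v = subTm ρ (ρ' v)

subTm-liftS-wk : ∀ {Γ Δ σ τ} (ρ : Sub Γ Δ) (t : Tm Δ σ) →
  subTm (liftS {τ = τ} ρ) (wkTm t) ≡ wkTm (subTm ρ t)
subTm-liftS-wk ρ (var v) = refl
subTm-liftS-wk ρ (con c) = refl
subTm-liftS-wk ρ (f · t) = cong₂ _·_ (subTm-liftS-wk ρ f) (subTm-liftS-wk ρ t)

liftS-fusion : ∀ {Γ Δ Θ τ} {ρ : Sub Γ Δ} {ρ' : Sub Δ Θ} {ρ'' : Sub Γ Θ} →
  SubEq (ρ ∘S ρ') ρ'' → SubEq (liftS {τ = τ} ρ ∘S liftS ρ') (liftS ρ'')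
liftS-fusion e here = refl
liftS-fusion {ρ = ρ} {ρ'} e (there v) = trans (subTm-liftS-wk ρ (ρ' v)) (cong wkTm (e v))

subTm-fusion : ∀ {Γ Δ Θ σ} {ρ : Sub Γ Δ} {ρ' : Sub Δ Θ} {ρ'' : Sub Γ Θ} →
  SubEq (ρ ∘S ρ') ρ'' → (t : Tm Θ σ) → subTm ρ (subTm ρ' t) ≡ subTm ρ'' t
subTm-fusion e (var v) = e v
subTm-fusion e (con c) = refl
subTm-fusion e (f · t) = cong₂ _·_ (subTm-fusion e f) (subTm-fusion e t)

subAt-fusion : ∀ {Γ Δ Θ} {ρ : Sub Γ Δ} {ρ' : Sub Δ Θ} {ρ'' : Sub Γ Θ} →
  SubEq (ρ ∘S ρ') ρ'' → (a : Atom Θ) → subAt ρ (subAt ρ' a) ≡ subAt ρ'' a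
subAt-fusion e (s =ℕ t) = cong₂ _=ℕ_ (subTm-fusion e s) (subTm-fusion e t)
subAt-fusion e (s =𝔹 t) = cong₂ _=𝔹_ (subTm-fusion e s) (subTm-fusion e t)
subAt-fusion e (s ∈' t) = cong₂ _∈'_ (subTm-fusion e s) (subTm-fusion e t)

subL-fusion : ∀ {Γ Δ Θ} {ρ : Sub Γ Δ} {ρ' : Sub Δ Θ} {ρ'' : Sub Γ Θ} →
  SubEq (ρ ∘S ρ') ρ'' → (φ : LForm Θ) → subL ρ (subL ρ' φ) ≡ subL ρ'' φ
subL-fusion e (atom a) = cong atom (subAt-fusion e a)
subL-fusion e 𝟎 = refl
subL-fusion e (φ ⊸ ψ) = cong₂ _⊸_ (subL-fusion e φ) (subL-fusion e ψ)
subL-fusion e (φ ⊗ ψ) = cong₂ _⊗_ (subL-fusion e φ) (subL-fusion e ψ)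
subL-fusion e (φ & ψ) = cong₂ _&_ (subL-fusion e φ) (subL-fusion e ψ)
subL-fusion e (φ ⊕ ψ) = cong₂ _⊕_ (subL-fusion e φ) (subL-fusion e ψ)
subL-fusion e (! φ) = cong !_ (subL-fusion e φ)
subL-fusion e (∀ₗ σ φ) = cong (∀ₗ σ) (subL-fusion (liftS-fusion e) φ)
subL-fusion e (∃ₗ σ φ) = cong (∃ₗ σ) (subL-fusion (liftS-fusion e) φ)

liftS-identity : ∀ {Γ τ} {ρ : Sub Γ Γ} → SubEq ρ idS → SubEq (liftS {τ = τ} ρ) idS
liftS-identity e here = refl
liftS-identity e (there v) = cong wkTm (e v)

subTm-identity : ∀ {Γ σ} {ρ : Sub Γ Γ} → SubEq ρ idS → (t : Tm Γ σ) → subTm ρ t ≡ t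
subTm-identity e (var v) = e v
subTm-identity e (con c) = refl
subTm-identity e (f · t) = cong₂ _·_ (subTm-identity e f) (subTm-identity e t)

subAt-identity : ∀ {Γ} {ρ : Sub Γ Γ} → SubEq ρ idS → (a : Atom Γ) → subAt ρ a ≡ a
subAt-identity e (s =ℕ t) = cong₂ _=ℕ_ (subTm-identity e s) (subTm-identity e t)
subAt-identity e (s =𝔹 t) = cong₂ _=𝔹_ (subTm-identity e s) (subTm-identity e t)
subAt-identity e (s ∈' t) = cong₂ _∈'_ (subTm-identity e s) (subTm-identity e t)

subL-identity : ∀ {Γ} {ρ : Sub Γ Γ} → SubEq ρ idS → (φ : LForm Γ) → subL ρ φ ≡ φ
subL-identity e (atom a) = cong atom (subAt-identity e a)
subL-identity e 𝟎 = refl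
subL-identity e (φ ⊸ ψ) = cong₂ _⊸_ (subL-identity e φ) (subL-identity e ψ)
subL-identity e (φ ⊗ ψ) = cong₂ _⊗_ (subL-identity e φ) (subL-identity e ψ)
subL-identity e (φ & ψ) = cong₂ _&_ (subL-identity e φ) (subL-identity e ψ)
subL-identity e (φ ⊕ ψ) = cong₂ _⊕_ (subL-identity e φ) (subL-identity e ψ)
subL-identity e (! φ) = cong !_ (subL-identity e φ)
subL-identity e (∀ₗ σ φ) = cong (∀ₗ σ) (subL-identity (liftS-identity e) φ)
subL-identity e (∃ₗ σ φ) = cong (∃ₗ σ) (subL-identity (liftS-identity e) φ)

instantiate-weakened-body : ∀ {Γ σ} (φ : LForm (σ ∷ Γ)) →
  subL (var here ▸ idS) (subL (liftS (λ v → var (there v))) φ) ≡ φ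
instantiate-weakened-body φ = trans (subL-fusion inverse φ) (subL-identity (λ v → refl) φ)
  where
    inverse : SubEq ((var here ▸ idS) ∘S liftS (λ v → var (there v))) idS
    inverse here = refl
    inverse (there v) = refl

∀-cong : ∀ {Γ σ} {φ ψ : LForm (σ ∷ Γ)} → φ ⟺ ψ → (∀ₗ σ φ) ⟺ (∀ₗ σ ψ)
∀-cong {φ = φ} {ψ} (φ⊢ψ , ψ⊢φ) =
  ∀R (∀L (var here) (subst (λ χ → _ ∣ χ ∷ [] ⊢ ψ) (sym (instantiate-weakened-body φ)) φ⊢ψ)) ,
  ∀R (∀L (var here) (subst (λ χ → _ ∣ χ ∷ [] ⊢ φ) (sym (instantiate-weakened-body ψ)) ψ⊢φ))

module _ {Γ : Ctx} where
  takeₜ-transport : ∀ {X X' Y Y'} (e : X ≡ X') (e' : Y ≡ Y') (t : Tms Γ (X ++ Y)) →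
    takeₜ X' (subst (Tms Γ) (cong₂ _++_ e e') t) ≡ subst (Tms Γ) e (takeₜ X t)
  takeₜ-transport refl refl t = refl

  dropₜ-transport : ∀ {X X' Y Y'} (e : X ≡ X') (e' : Y ≡ Y') (t : Tms Γ (X ++ Y)) →
    dropₜ X' (subst (Tms Γ) (cong₂ _++_ e e') t) ≡ subst (Tms Γ) e' (dropₜ X t)
  dropₜ-transport refl refl t = refl

  takeₜ-transportˡ : ∀ {X X' Y} (e : X ≡ X') (t : Tms Γ (X ++ Y)) →
    takeₜ X' (subst (Tms Γ) (cong (_++ Y) e) t) ≡ subst (Tms Γ) e (takeₜ X t)
  takeₜ-transportˡ refl t = refl

  dropₜ-transportˡ : ∀ {X X' Y} (e : X ≡ X') (t : Tms Γ (X ++ Y)) →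
    dropₜ X' (subst (Tms Γ) (cong (_++ Y) e) t) ≡ dropₜ X t
  dropₜ-transportˡ refl t = refl

  appₜ-transport : ∀ {S S' X X'} (e : S ≡ S') (e' : X ≡ X')
    (f : Tms Γ (map (S ⇒*_) X)) (xs : Tms Γ S) →
    appₜ (subst (Tms Γ) (cong₂ (λ u v → map (u ⇒*_) v) e e') f) (subst (Tms Γ) e xs)
      ≡ subst (Tms Γ) e' (appₜ f xs)
  appₜ-transport refl refl f xs = refl

  appₜ-transportʳ : ∀ {S X X'} (e : X ≡ X') (f : Tms Γ (map (S ⇒*_) X)) (xs : Tms Γ S) →
    appₜ (subst (Tms Γ) (cong (map (S ⇒*_)) e) f) xs ≡ subst (Tms Γ) e (appₜ f xs)
  appₜ-transportʳ refl f xs = refl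

renTms-transport : ∀ {Γ Γ' X X'} (r : Ren Γ' Γ) (e : X ≡ X') (xs : Tms Γ X) →
  renTms r (subst (Tms Γ) e xs) ≡ subst (Tms Γ') e (renTms r xs)
renTms-transport r refl xs = refl

-- If two bodies correspond under ⁺ for all instances of the bound variables,
-- so do the linear and intuitionistic bounded quantifications over them
-- (∀y(!(y∈a) ⊸ …) is literally (∀y(y∈a ⊃ …))⁺).
∀∈-cong : ∀ {Γ τs' τs} (e : τs' ≡ τs) (as : Tms Γ (map _* τs'))
  (k' : Body LForm Γ τs') (k : Body IForm Γ τs) →
  (∀ {Γ'} (r : Ren Γ' Γ) ys → k' r ys ⟺ (k r (subst (Tms Γ') e ys)) ⁺) →
  ∀∈L τs' as k' ⟺ (∀∈I τs (subst (Tms Γ) (cong (map _*) e) as) k) ⁺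
∀∈-cong {τs' = []} refl []ₜ k' k bodies = bodies (λ v → v) []ₜ
∀∈-cong {τs' = τ ∷ τs} refl (a ∷ₜ as) k' k bodies =
  ∀-cong (⊸-cong ⟺-refl
    (∀∈-cong refl (wkTms as) _ _ (λ r ys → bodies (λ v → r (there v)) (var (r here) ∷ₜ ys))))

pW : ∀ {Δ} (A : IForm Δ) → WL (A ⁺) ≡ W A
pW A = proj₁ (WC⁺ A)

pC : ∀ {Δ} (A : IForm Δ) → CL (A ⁺) ≡ C A
pC A = proj₂ (WC⁺ A)

Agrees : ∀ {Δ} → IForm Δ → Set
Agrees {Δ} A = ∀ {Γ} (ρ : Sub Γ Δ) (xs : Tms Γ (WL (A ⁺))) (ys : Tms Γ (CL (A ⁺))) →
  ∣ A ⁺ ∣ ρ xs ys ⟺ (DN A ρ (subst (Tms Γ) (pW A) xs) (subst (Tms Γ) (pC A) ys)) ⁺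

-- Each induction step only has to align the tuple splittings of both sides.
agrees-∧ : ∀ {Δ} {A B : IForm Δ} → Agrees A → Agrees B → Agrees (A ∧ B)
agrees-∧ {A = A} {B} hA hB ρ xv yw
  rewrite takeₜ-transport (pW A) (pW B) xv | takeₜ-transport (pC A) (pC B) yw
        | dropₜ-transport (pW A) (pW B) xv | dropₜ-transport (pC A) (pC B) yw
  = &-cong (hA ρ _ _) (hB ρ _ _)

-- cond_z(φ,ψ) is literally ((z = T ⊃ A) ∧ (z = F ⊃ B))⁺ for the matching A, B.
agrees-∨ : ∀ {Δ} {A B : IForm Δ} → Agrees A → Agrees B → Agrees (A ∨ B)
agrees-∨ {A = A} {B} hA hB ρ xvz yw
  rewrite dropₜ-transport (pW A) (cong (_++ (𝕓 ∷ [])) (pW B)) xvz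
        | takeₜ-transport (pW A) (cong (_++ (𝕓 ∷ [])) (pW B)) xvz
        | takeₜ-transportˡ {Y = 𝕓 ∷ []} (pW B) (dropₜ (WL (A ⁺)) xvz)
        | dropₜ-transportˡ {Y = 𝕓 ∷ []} (pW B) (dropₜ (WL (A ⁺)) xvz)
        | takeₜ-transport (pC A) (pC B) yw | dropₜ-transport (pC A) (pC B) yw
  = &-cong (⊸-cong ⟺-refl (hA ρ _ _)) (⊸-cong ⟺-refl (hB ρ _ _))

-- The two blocks of witness types of A ⊃ B: challenge functionals 𝐟 and
-- witness functionals 𝐠 (the components of pW (A ⊃ B)).
pF : ∀ {Δ} (A B : IForm Δ) →
  map ((WL (A ⁺) ++ CL (B ⁺)) ⇒*_) (map _* (CL (A ⁺))) ≡ map ((W A ++ C B) ⇒*_) (map _* (C A))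
pF A B = cong₂ (λ u v → map (u ⇒*_) v) (cong₂ _++_ (pW A) (pC B)) (cong (map _*) (pC A))

pG : ∀ {Δ} (A B : IForm Δ) → map (WL (A ⁺) ⇒*_) (WL (B ⁺)) ≡ map (W A ⇒*_) (W B)
pG A B = cong₂ (λ u v → map (u ⇒*_) v) (pW A) (pW B)

-- |!A⁺ ⊸ B⁺| bangs the bounded quantification of |A⁺| over the challenge
-- sets 𝐟𝐱𝐰, matching the bounded premise ∀𝐲∈𝐟𝐱𝐰 A_DN(𝐱;𝐲) of (A ⊃ B)_DN.
agrees-⊃ : ∀ {Δ} {A B : IForm Δ} → Agrees A → Agrees B → Agrees (A ⊃ B)
agrees-⊃ {A = A} {B} hA hB ρ fg xw
  rewrite takeₜ-transport (pF A B) (pG A B) fg | dropₜ-transport (pF A B) (pG A B) fg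
        | takeₜ-transport (pW A) (pC B) xw | dropₜ-transport (pW A) (pC B) xw
        | appₜ-transport (cong₂ _++_ (pW A) (pC B)) (cong (map _*) (pC A))
            (takeₜ (map ((WL (A ⁺) ++ CL (B ⁺)) ⇒*_) (map _* (CL (A ⁺)))) fg) xw
        | appₜ-transport (pW A) (pW B)
            (dropₜ (map ((WL (A ⁺) ++ CL (B ⁺)) ⇒*_) (map _* (CL (A ⁺)))) fg)
            (takeₜ (WL (A ⁺)) xw)
  = ⊸-cong (!-cong (∀∈-cong (pC A) _ _ _ premises)) (hB ρ _ _)
  where
    x : Tms _ (WL (A ⁺))
    x = takeₜ (WL (A ⁺)) xw

    premises : ∀ {Γ'} (r : Ren Γ' _) (ys : Tms Γ' (CL (A ⁺))) →
      ∣ A ⁺ ∣ (r ⊙ ρ) (renTms r x) ys ⟺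
      (DN A (r ⊙ ρ) (renTms r (subst (Tms _) (pW A) x)) (subst (Tms Γ') (pC A) ys)) ⁺
    premises r ys rewrite renTms-transport r (pW A) x = hA (r ⊙ ρ) _ ys

-- The quantified variable is the last challenge (∀) or witness (∃) on both sides.
agrees-∀ : ∀ {Δ σ} {A : IForm (σ ∷ Δ)} → Agrees A → Agrees (∀' σ A)
agrees-∀ {σ = σ} {A} hA ρ f yz
  rewrite dropₜ-transportˡ {Y = σ ∷ []} (pC A) yz | takeₜ-transportˡ {Y = σ ∷ []} (pC A) yz
        | appₜ-transportʳ (pW A) f (headₜ (dropₜ (CL (A ⁺)) yz) ∷ₜ []ₜ)
  = hA _ _ _

agrees-∃ : ∀ {Δ σ} {A : IForm (σ ∷ Δ)} → Agrees A → Agrees (∃' σ A)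
agrees-∃ {σ = σ} {A} hA ρ xz ys
  rewrite dropₜ-transportˡ {Y = σ ∷ []} (pW A) xz | takeₜ-transportˡ {Y = σ ∷ []} (pW A) xz
  = hA _ _ _

agrees : ∀ {Δ} (A : IForm Δ) → Agrees A
agrees (atom a) ρ xs ys = ⟺-refl
agrees ⊥' ρ xs ys = ⟺-refl
agrees (A ∧ B) = agrees-∧ {A = A} {B} (agrees A) (agrees B)
agrees (A ∨ B) = agrees-∨ {A = A} {B} (agrees A) (agrees B)
agrees (A ⊃ B) = agrees-⊃ {A = A} {B} (agrees A) (agrees B)
agrees (∀' σ A) = agrees-∀ {A = A} (agrees A)
agrees (∃' σ A) = agrees-∃ {A = A} (agrees A)

-- Theorem 4.6: instantiate `agrees` at the tuples transported back from
-- W A, C A; the two transports cancel.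
theorem4p6 : ∀ {Γ Δ} (A : IForm Δ) (ρ : Sub Γ Δ) (xs : Tms Γ (W A)) (ys : Tms Γ (C A)) →
    Γ ∣ [] ⊢ ((∣ A ⁺∣ ρ xs ys ⊸ (DN A ρ xs ys) ⁺) & ((DN A ρ xs ys) ⁺ ⊸ ∣ A ⁺∣ ρ xs ys))
theorem4p6 {Γ} A ρ xs ys
  with agrees A ρ (subst (Tms Γ) (sym (pW A)) xs) (subst (Tms Γ) (sym (pC A)) ys)
... | equivalence
  rewrite subst-subst-sym {P = Tms Γ} (pW A) {xs} | subst-subst-sym {P = Tms Γ} (pC A) {ys}
  = &R (⊸R (proj₁ equivalence)) (⊸R (proj₂ equivalence))
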